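{- Let $M$ be an oriented $3$-valent map. Then: (i) for corners $c,c',c''$ at a common vertex, $sh(c,c'')\equiv sh(c,c')+sh(c',c'')\pmod 3$; (ii) for any function $\phi:V(M)\to Corner(M)$ such that $\phi(v)$ is a corner at $v$ for every $v$, and any $f\in OrMap(M)$, the residue $\sum_{v\in V(M)} sh\big(f(\phi(v)),\phi(f(v))\big)\pmod 3$ does not depend on $\phi$; denote it $sh(f)\in\mathbb{Z}_3$; (iii) for $f,g\in OrMap(M)$, $sh(f\circ g)\equiv sh(f)+sh(g)\pmod 3$; (iv) $sh$ is not identically $0$ on $OrMap(M)$; (v) every $f\in Rubik(M)$ (acting on corners) satisfies $sh(f)\equiv 0\pmod 3$.
   Context: A $3$-valent map $M$ is a cellularly embedded $3$-regular graph on a surface; $V(M)$, $E(M)$, $Face(M)$ denote its vertices, edges and faces. Throughout, every face boundary is a simple cycle, every edge lies in two distinct faces, and the three faces at any vertex are pairwise distinct. A corner is a pair $(F,v)$ with $v$ a vertex of the face $F$; $Corner(M)$ is the set of corners, and each vertex $v$ lies in exactly three corners $C_v$. Side movement: let $F$ have boundary cycle $v_1,\dots,v_p$ (indices mod $p$, in a chosen direction), edges $e_i=v_iv_{i+1}$, and let $G_i$ be the face other than $F$containing $e_i$. The side movement $sm(M,F)$ permutes corners by $(F,v_i)\mapsto(F,v_{i+1})$, $(G_{i-1},v_i)\mapsto(G_i,v_{i+1})$, $(G_i,v_i)\mapsto(G_{i+1},v_{i+1})$, fixing all other corners (it also permutes side edges $(F,e_i)\mapsto(F,e_{i+1})$,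 $(G_i,e_i)\mapsto(G_{i+1},e_{i+1})$). $Rubik(M)$ is the group generated by all $sm(M,F)$, $F\in Face(M)$. When $M$ is oriented, the orientation gives a cyclic ("direct") order on each $C_v$; let $r$ be the rotation of $C_v$ advancing one step in this order. $OrMap(M)$ is the set of permutations of $Corner(M)$ that map each triple $C_v$ onto some triple $C_{v'}$ preserving the cyclic orders (such $f$ induces a permutation $v\mapsto f(v)$ of $V(M)$). For corners $c,c'$ at the same vertex, $sh(c,c')$ is the $k\in\{0,1,2\}$ with $r^k(c)=c'$. -}

module Defs where

open import Data.Nat using (ℕ; zero; suc; _+_; _∸_; _<_; _%_)
open import Data.Fin using (Fin; toℕ) renaming (zero to fz; suc to fs)
open import Data.Product using (_×_; _,_; proj₁; proj₂; ∃)
open import Relation.Binary.PropositionalEquality using (_≡_; _≢_)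
open import Relation.Nullary using (¬_)

-- Oriented 3-valent maps are encoded by rotation systems.  The three corners at vertex v are (v , k), k : Fin 3,
-- listed in the direct cyclic order given by the orientation.
-- Corner (v , k) is identified with the dart (half-edge) (v , k); it is the
-- corner lying between the darts (v , k) and (v , k+1).

Corner : ℕ → Set
Corner m = Fin m × Fin 3

suc3 : Fin 3 → Fin 3
suc3 fz = fs fz
suc3 (fs fz) = fs (fs fz)
suc3 (fs (fs fz)) = fz

rot : {m : ℕ} → Corner m → Corner m
rot (v , k) = v , suc3 k

iter : {A : Set} → (A → A) → ℕ → A → A
iter f zero x = x
iter f (suc n) x = f (iter f n x)

vertexOf : {m : ℕ} → Corner m → Fin m
vertexOf = proj₁

-- A 3-valent oriented map with m vertices: α is the edge involution on darts.
-- The face-traversal on corners is  φ c = α (rot c)  (faces = φ-orbits).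
record Map3 (m : ℕ) : Set where
  field
    α : Corner m → Corner m
    α-invol : ∀ c → α (α c) ≡ c
    α-nofix : ∀ c → α c ≢ c
    nonempty : 0 < m
  φ : Corner m → Corner m
  φ c = α (rot c)
  field
    face-simple : ∀ c i j → vertexOf (iter φ i c) ≡ vertexOf (iter φ j c) →
                  iter φ i c ≡ iter φ j c
    -- the two faces containing the edge of dart c (corners c and rot (rot c)) are distinct
    edge-two-faces : ∀ c i → iter φ i c ≢ rot (rot c)
    vertex-faces-distinct : ∀ c i → (iter φ i c ≢ rot c) × (iter φ i c ≢ rot (rot c))

-- sh(c , c') : the k ∈ {0,1,2} with r^k c = c' (for c, c' at the same vertex)
sh : {m : ℕ} → Corner m → Corner m → ℕ
sh (_ , k) (_ , k') = (toℕ k' + 3 ∸ toℕ k) % 3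

-- OrMap(M): permutations of corners mapping each triple C_v onto a triple
-- C_v' preserving the cyclic orders (equivalently: bijective and commuting with r)
record IsOrMap {m : ℕ} (f : Corner m → Corner m) : Set where
  field
    inverse : Corner m → Corner m
    inverseˡ : ∀ c → inverse (f c) ≡ c
    inverseʳ : ∀ c → f (inverse c) ≡ c
    preserves-order : ∀ c → f (rot c) ≡ rot (f c)

vmap : {m : ℕ} → (Corner m → Corner m) → Fin m → Fin m
vmap f v = vertexOf (f (v , fz))

sumFin : (m : ℕ) → (Fin m → ℕ) → ℕ
sumFin zero g = 0
sumFin (suc m) g = g fz + sumFin m (λ i → g (fs i))

shSum : {m : ℕ} → (Corner m → Corner m) → (Fin m → Corner m) → ℕ
shSum {m} f ϕ = sumFin m (λ v → sh (f (ϕ v)) (ϕ (vmap f v)))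

IsChoice : {m : ℕ} → (Fin m → Corner m) → Set
IsChoice ϕ = ∀ v → vertexOf (ϕ v) ≡ v

shOf : {m : ℕ} → (Corner m → Corner m) → ℕ
shOf f = shSum f (λ v → v , fz) % 3

-- s is the side movement sm(M , F) where F is the face through corner d₀,
-- traversed in the direction of φ: the boundary corners are c_i = φ^i d₀,
-- and (G_{i-1}, v_i) = r² c_i, (G_i , v_i) = r c_i.
IsSideMovement : {m : ℕ} → Map3 m → Corner m → (Corner m → Corner m) → Set
IsSideMovement {m} M d₀ s =
  (∀ i k → s (iter rot k (iter φ i d₀)) ≡ iter rot k (iter φ (suc i) d₀)) ×
  (∀ c → (∀ i → vertexOf c ≢ vertexOf (iter φ i d₀)) → s c ≡ c)
  where open Map3 M

-- Rubik(M): the group generated by the side movements (finite, so the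
-- monoid generated under composition suffices)
data Rubik {m : ℕ} (M : Map3 m) : (Corner m → Corner m) → Set where
  rubik-id : Rubik M (λ c → c)
  rubik-step : ∀ d₀ s g → IsSideMovement M d₀ s → Rubik M g → Rubik M (λ c → s (g c))

-- A map f commuting with the rotation r acts on corners as (v , k) ↦ (π v , k + t v) for a
-- permutation π of the vertices and a twist t : V → ℤ₃.  If a v is the position of ϕ v, the
-- summand of sh f is a (π v) − a v − t v mod 3, and the differences a ∘ π − a sum to 0 because
-- π permutes the vertices; so sh f = − Σ t whatever ϕ is.  Twists add under composition, which
-- gives (iii), and rotating the corners at a single vertex has total twist 1.  A side movement
-- along a face F sends the corner of F at each of its vertices to the corner of F at the next
-- one, so its twist is label ∘ π − label with label v the position of F's corner at v (0 off F),
-- which again sums to 0.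

module Submission where

open import Defs
open import Level using (0ℓ)
open import Algebra.Bundles using (AbelianGroup)
open import Data.Nat using (ℕ; zero; suc; _+_; _*_; _∸_; _%_; _/_; _<_; NonZero)
open import Data.Nat.Properties using (+-comm; +-assoc; +-suc; n<1+n; m+[n∸m]≡n)
open import Data.Nat.DivMod using ([m+n]%n≡m%n; m≡m%n+[m/n]*n; m%n<n; _mod_)
open import Data.Fin as Fin using (Fin; toℕ)
open import Data.Fin.Properties using (_≟_; any?; pigeonhole; toℕ-fromℕ<)
open import Data.Fin.Patterns using (0F; 1F; 2F)
open import Data.Fin.Permutation as Perm using (Permutation; _⟨$⟩ʳ_; _∘ₚ_)
open import Data.Vec.Functional using (Vector)
open import Function.Base using (_∘_)
open import Function.Definitions using (Injective)
open import Data.Empty using (⊥-elim)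
open import Data.Product using (Σ; _×_; _,_; proj₁; proj₂; ∃)
open import Relation.Nullary using (Dec; yes; no; ¬_; contradiction)
open import Relation.Nullary.Decidable using (map′)
open import Relation.Binary.PropositionalEquality
  using (_≡_; _≢_; refl; sym; trans; cong; cong₂; isEquivalence; module ≡-Reasoning)

-- Arithmetic modulo 3

infixl 6 _+₃_
_+₃_ : Fin 3 → Fin 3 → Fin 3
0F +₃ y = y
1F +₃ y = suc3 y
2F +₃ y = suc3 (suc3 y)

-₃_ : Fin 3 → Fin 3
-₃ 0F = 0F
-₃ 1F = 2F
-₃ 2F = 1F

suc3³ : ∀ x → suc3 (suc3 (suc3 x)) ≡ x
suc3³ 0F = refl
suc3³ 1F = refl
suc3³ 2F = refl

+₃-sucˡ : ∀ x y → suc3 x +₃ y ≡ suc3 (x +₃ y)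
+₃-sucˡ 0F y = refl
+₃-sucˡ 1F y = refl
+₃-sucˡ 2F y = sym (suc3³ y)

+₃-identityʳ : ∀ x → x +₃ 0F ≡ x
+₃-identityʳ 0F = refl
+₃-identityʳ 1F = refl
+₃-identityʳ 2F = refl

+₃-assoc : ∀ x y z → (x +₃ y) +₃ z ≡ x +₃ (y +₃ z)
+₃-assoc 0F y z = refl
+₃-assoc 1F y z = +₃-sucˡ y z
+₃-assoc 2F y z = trans (+₃-sucˡ (suc3 y) z) (cong suc3 (+₃-sucˡ y z))

+₃-comm : ∀ x y → x +₃ y ≡ y +₃ x
+₃-comm 0F 0F = refl
+₃-comm 0F 1F = refl
+₃-comm 0F 2F = refl
+₃-comm 1F 0F = refl
+₃-comm 1F 1F = refl
+₃-comm 1F 2F = refl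
+₃-comm 2F 0F = refl
+₃-comm 2F 1F = refl
+₃-comm 2F 2F = refl

-₃-inverseʳ : ∀ x → x +₃ -₃ x ≡ 0F
-₃-inverseʳ 0F = refl
-₃-inverseʳ 1F = refl
-₃-inverseʳ 2F = refl

-₃-inverseˡ : ∀ x → -₃ x +₃ x ≡ 0F
-₃-inverseˡ x = trans (+₃-comm (-₃ x) x) (-₃-inverseʳ x)

ℤ₃ : AbelianGroup 0ℓ 0ℓ
ℤ₃ = record
  { Carrier = Fin 3
  ; _≈_ = _≡_
  ; _∙_ = _+₃_
  ; ε = 0F
  ; _⁻¹ = -₃_
  ; isAbelianGroup = record
    { isGroup = record
      { isMonoid = record
        { isSemigroup = record
          { isMagma = record { isEquivalence = isEquivalence ; ∙-cong = cong₂ _+₃_ }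
          ; assoc = +₃-assoc }
        ; identity = (λ _ → refl) , +₃-identityʳ }
      ; inverse = -₃-inverseˡ , -₃-inverseʳ
      ; ⁻¹-cong = cong -₃_ }
    ; comm = +₃-comm } }

module _ {a ℓ} (G : AbelianGroup a ℓ) where
  open AbelianGroup G
    using (Carrier; _≈_; _∙_; ε; _⁻¹; _-_; setoid; ∙-congˡ; ∙-congʳ; inverseʳ; commutativeMonoid)
  open import Algebra.Properties.AbelianGroup G using (⁻¹-∙-comm; ε⁻¹≈ε)
  open import Algebra.Properties.CommutativeMonoid.Sum commutativeMonoid
    using (sum; ∑-distrib-+; ∑-permute)
  open import Relation.Binary.Reasoning.Setoid setoid

  ∑-⁻¹ : ∀ {n} (f : Vector Carrier n) → sum (λ i → f i ⁻¹) ≈ sum f ⁻¹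
  ∑-⁻¹ {zero} f = begin ε ≈⟨ ε⁻¹≈ε ⟨ ε ⁻¹ ∎
  ∑-⁻¹ {suc n} f = begin
    f 0F ⁻¹ ∙ sum (λ i → f (Fin.suc i) ⁻¹)  ≈⟨ ∙-congˡ (∑-⁻¹ (λ i → f (Fin.suc i))) ⟩
    f 0F ⁻¹ ∙ sum (λ i → f (Fin.suc i)) ⁻¹  ≈⟨ ⁻¹-∙-comm (f 0F) _ ⟩
    sum f ⁻¹                                 ∎

  ∑-coboundary : ∀ {n} (π : Permutation n n) (f : Vector Carrier n) →
                 sum (λ i → f (π ⟨$⟩ʳ i) - f i) ≈ ε
  ∑-coboundary π f = begin
    sum (λ i → f (π ⟨$⟩ʳ i) - f i)                ≈⟨ ∑-distrib-+ (λ i → f (π ⟨$⟩ʳ i)) (λ i → f i ⁻¹) ⟩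
    sum (λ i → f (π ⟨$⟩ʳ i)) ∙ sum (λ i → f i ⁻¹)  ≈⟨ ∙-congˡ (∑-⁻¹ f) ⟩
    sum (λ i → f (π ⟨$⟩ʳ i)) - sum f                ≈⟨ ∙-congʳ (∑-permute f π) ⟨
    sum f - sum f                                  ≈⟨ inverseʳ (sum f) ⟩
    ε                                              ∎

module _ {A : Set} (f : A → A) where

  iter-+ : ∀ a b x → iter f (a + b) x ≡ iter f a (iter f b x)
  iter-+ zero b x = refl
  iter-+ (suc a) b x = cong f (iter-+ a b x)

  iter-injective : Injective _≡_ _≡_ f → ∀ n → Injective _≡_ _≡_ (iter f n)
  iter-injective f-inj zero e = e
  iter-injective f-inj (suc n) e = iter-injective f-inj n (f-inj e)

  iter-cancel : Injective _≡_ _≡_ f → ∀ i n {x} → iter f i x ≡ iter f (i + n) x → iter f n x ≡ x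
  iter-cancel f-inj i n {x} e = sym (iter-injective f-inj i (trans e (iter-+ i n x)))

  module _ {p x} (returns : iter f p x ≡ x) where

    iter-*-period : ∀ q → iter f (q * p) x ≡ x
    iter-*-period zero = refl
    iter-*-period (suc q) =
      trans (iter-+ p (q * p) x) (trans (cong (iter f p) (iter-*-period q)) returns)

    iter-% : .{{_ : NonZero p}} → ∀ i → iter f (i % p) x ≡ iter f i x
    iter-% i = begin
      iter f (i % p) x                        ≡⟨ cong (iter f (i % p)) (iter-*-period (i / p)) ⟨
      iter f (i % p) (iter f (i / p * p) x)   ≡⟨ iter-+ (i % p) (i / p * p) x ⟨
      iter f (i % p + i / p * p) x            ≡⟨ cong (λ n → iter f n x) (m≡m%n+[m/n]*n i p) ⟨
      iter f i x                              ∎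
      where open ≡-Reasoning

open AbelianGroup ℤ₃ using (_-_)
open import Algebra.Properties.AbelianGroup ℤ₃ using (⁻¹-∙-comm; //-rightDividesˡ; \\-leftDividesʳ)
open import Algebra.Properties.CommutativeMonoid.Sum (AbelianGroup.commutativeMonoid ℤ₃)
  using (sum; sum-cong-≗; ∑-distrib-+; ∑-permute; sum-replicate-zero)

mod₃ : ℕ → Fin 3
mod₃ zero = 0F
mod₃ (suc n) = suc3 (mod₃ n)

toℕ-mod₃ : ∀ n → toℕ (mod₃ n) ≡ n % 3
toℕ-mod₃ 0 = refl
toℕ-mod₃ 1 = refl
toℕ-mod₃ 2 = refl
toℕ-mod₃ (suc (suc (suc n))) = begin
  toℕ (suc3 (suc3 (suc3 (mod₃ n)))) ≡⟨ cong toℕ (suc3³ (mod₃ n)) ⟩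
  toℕ (mod₃ n)                      ≡⟨ toℕ-mod₃ n ⟩
  n % 3                             ≡⟨ [m+n]%n≡m%n n 3 ⟨
  (n + 3) % 3                       ≡⟨ cong (_% 3) (+-comm n 3) ⟩
  (3 + n) % 3                       ∎
  where open ≡-Reasoning

mod₃-toℕ : ∀ x → mod₃ (toℕ x) ≡ x
mod₃-toℕ 0F = refl
mod₃-toℕ 1F = refl
mod₃-toℕ 2F = refl

mod₃-+ : ∀ a b → mod₃ (a + b) ≡ mod₃ a +₃ mod₃ b
mod₃-+ zero b = refl
mod₃-+ (suc a) b = trans (cong suc3 (mod₃-+ a b)) (sym (+₃-sucˡ (mod₃ a) (mod₃ b)))

toℕ-+₃ : ∀ x y → toℕ (x +₃ y) ≡ (toℕ x + toℕ y) % 3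
toℕ-+₃ x y = begin
  toℕ (x +₃ y)                          ≡⟨ cong₂ (λ a b → toℕ (a +₃ b)) (mod₃-toℕ x) (mod₃-toℕ y) ⟨
  toℕ (mod₃ (toℕ x) +₃ mod₃ (toℕ y))    ≡⟨ cong toℕ (mod₃-+ (toℕ x) (toℕ y)) ⟨
  toℕ (mod₃ (toℕ x + toℕ y))            ≡⟨ toℕ-mod₃ (toℕ x + toℕ y) ⟩
  (toℕ x + toℕ y) % 3                   ∎
  where open ≡-Reasoning

sh-position : ∀ {m} (c c' : Corner m) → sh c c' ≡ toℕ (proj₂ c' - proj₂ c)
sh-position (_ , 0F) (_ , 0F) = refl
sh-position (_ , 0F) (_ , 1F) = refl
sh-position (_ , 0F) (_ , 2F) = refl
sh-position (_ , 1F) (_ , 0F) = refl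
sh-position (_ , 1F) (_ , 1F) = refl
sh-position (_ , 1F) (_ , 2F) = refl
sh-position (_ , 2F) (_ , 0F) = refl
sh-position (_ , 2F) (_ , 1F) = refl
sh-position (_ , 2F) (_ , 2F) = refl

mod₃-sh : ∀ {m} (c c' : Corner m) → mod₃ (sh c c') ≡ proj₂ c' - proj₂ c
mod₃-sh c c' = trans (cong mod₃ (sh-position c c')) (mod₃-toℕ _)

sh-additive : ∀ {m} (c c' c'' : Corner m) → sh c c'' ≡ (sh c c' + sh c' c'') % 3
sh-additive c@(_ , k) c'@(_ , k') c''@(_ , k'') = begin
  sh c c''                               ≡⟨ sh-position c c'' ⟩
  toℕ (k'' - k)                          ≡⟨ cong toℕ chasles ⟨
  toℕ ((k' - k) +₃ (k'' - k'))           ≡⟨ toℕ-+₃ (k' - k) (k'' - k') ⟩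
  (toℕ (k' - k) + toℕ (k'' - k')) % 3    ≡⟨ cong₂ (λ a b → (a + b) % 3)
                                                  (sh-position c c') (sh-position c' c'') ⟨
  (sh c c' + sh c' c'') % 3              ∎
  where
  open ≡-Reasoning
  chasles : (k' - k) +₃ (k'' - k') ≡ k'' - k
  chasles = begin
    (k' - k) +₃ (k'' - k')     ≡⟨ +₃-comm (k' - k) _ ⟩
    (k'' - k') +₃ (k' - k)     ≡⟨ +₃-assoc k'' (-₃ k') _ ⟩
    k'' +₃ (-₃ k' +₃ (k' - k)) ≡⟨ cong (k'' +₃_) (\\-leftDividesʳ k' (-₃ k)) ⟩
    k'' - k                    ∎

-- Rotation-equivariant corner maps

record TwistedForm {m : ℕ} (f : Corner m → Corner m) : Set where
  field
    vperm  : Permutation m m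
    twist  : Fin m → Fin 3
    action : ∀ v k → f (v , k) ≡ (vperm ⟨$⟩ʳ v , k +₃ twist v)

  totalTwist : Fin 3
  totalTwist = sum twist

open TwistedForm

rot-equivariant-action : ∀ {m} {f : Corner m → Corner m} → (∀ c → f (rot c) ≡ rot (f c)) →
                         ∀ v k → f (v , k) ≡ (vmap f v , k +₃ proj₂ (f (v , 0F)))
rot-equivariant-action f-rot v 0F = refl
rot-equivariant-action f-rot v 1F = f-rot (v , 0F)
rot-equivariant-action f-rot v 2F = trans (f-rot (v , 1F)) (cong rot (f-rot (v , 0F)))

orMap-twistedForm : ∀ {m} {f : Corner m → Corner m} → IsOrMap f → TwistedForm f
orMap-twistedForm {m} {f} isOrMap = record
  { vperm  = Perm.permutation (vmap f) vmap⁻¹ vmap-vmap⁻¹ vmap⁻¹-vmap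
  ; twist  = t
  ; action = act
  }
  where
  open IsOrMap isOrMap
  t : Fin m → Fin 3
  t v = proj₂ (f (v , 0F))
  act : ∀ v k → f (v , k) ≡ (vmap f v , k +₃ t v)
  act = rot-equivariant-action preserves-order
  vmap⁻¹ : Fin m → Fin m
  vmap⁻¹ w = proj₁ (inverse (w , 0F))
  vmap-vmap⁻¹ : ∀ w → vmap f (vmap⁻¹ w) ≡ w
  vmap-vmap⁻¹ w = cong proj₁ (trans (sym (act _ _)) (inverseʳ (w , 0F)))
  vmap⁻¹-vmap : ∀ v → vmap⁻¹ (vmap f v) ≡ v
  vmap⁻¹-vmap v = cong proj₁ (trans (cong inverse (sym untwisted)) (inverseˡ (v , -₃ t v)))
    where
    untwisted : f (v , -₃ t v) ≡ (vmap f v , 0F)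
    untwisted = trans (act v (-₃ t v)) (cong (vmap f v ,_) (-₃-inverseˡ (t v)))

twistedForm-id : ∀ {m} → TwistedForm {m} (λ c → c)
twistedForm-id = record
  { vperm  = Perm.id
  ; twist  = λ _ → 0F
  ; action = λ v k → cong (v ,_) (sym (+₃-identityʳ k))
  }

totalTwist-id : ∀ {m} → totalTwist (twistedForm-id {m}) ≡ 0F
totalTwist-id {m} = sum-replicate-zero m

twistedForm-∘ : ∀ {m} {f g : Corner m → Corner m} →
                TwistedForm f → TwistedForm g → TwistedForm (λ c → f (g c))
twistedForm-∘ {f = f} F G = record
  { vperm  = vperm G ∘ₚ vperm F
  ; twist  = λ v → twist G v +₃ twist F (vperm G ⟨$⟩ʳ v)
  ; action = λ v k → trans (cong f (action G v k))
                     (trans (action F _ _) (cong (_ ,_) (+₃-assoc k (twist G v) _)))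
  }

totalTwist-∘ : ∀ {m} {f g : Corner m → Corner m} (F : TwistedForm f) (G : TwistedForm g) →
               totalTwist (twistedForm-∘ F G) ≡ totalTwist F +₃ totalTwist G
totalTwist-∘ F G = begin
  sum (λ v → twist G v +₃ twist F (vperm G ⟨$⟩ʳ v))     ≡⟨ ∑-distrib-+ (twist G) _ ⟩
  totalTwist G +₃ sum (λ v → twist F (vperm G ⟨$⟩ʳ v))  ≡⟨ cong (totalTwist G +₃_) (∑-permute (twist F) (vperm G)) ⟨
  totalTwist G +₃ totalTwist F                           ≡⟨ +₃-comm (totalTwist G) (totalTwist F) ⟩
  totalTwist F +₃ totalTwist G                           ∎
  where open ≡-Reasoning

mod₃-sumFin : ∀ n (g : Fin n → ℕ) → mod₃ (sumFin n g) ≡ sum (λ v → mod₃ (g v))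
mod₃-sumFin zero g = refl
mod₃-sumFin (suc n) g =
  trans (mod₃-+ (g 0F) _) (cong (mod₃ (g 0F) +₃_) (mod₃-sumFin n (λ v → g (Fin.suc v))))

mod₃-shSum : ∀ {m} {f : Corner m → Corner m} {ϕ : Fin m → Corner m} (F : TwistedForm f) →
             IsChoice ϕ → mod₃ (shSum f ϕ) ≡ -₃ totalTwist F
mod₃-shSum {m} {f} {ϕ} F choice = begin
  mod₃ (shSum f ϕ)                                  ≡⟨ mod₃-sumFin m _ ⟩
  sum (λ v → mod₃ (sh (f (ϕ v)) (ϕ (vmap f v))))    ≡⟨ sum-cong-≗ summand ⟩
  sum (λ v → (a (π v) - a v) - twist F v)           ≡⟨ ∑-distrib-+ (λ v → a (π v) - a v) _ ⟩
  sum (λ v → a (π v) - a v) +₃ sum (λ v → -₃ twist F v)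
    ≡⟨ cong₂ _+₃_ (∑-coboundary ℤ₃ (vperm F) a) (∑-⁻¹ ℤ₃ (twist F)) ⟩
  -₃ totalTwist F                                   ∎
  where
  open ≡-Reasoning
  π : Fin m → Fin m
  π v = vperm F ⟨$⟩ʳ v
  a : Fin m → Fin 3
  a v = proj₂ (ϕ v)
  summand : ∀ v → mod₃ (sh (f (ϕ v)) (ϕ (vmap f v))) ≡ (a (π v) - a v) - twist F v
  summand v = begin
    mod₃ (sh (f (ϕ v)) (ϕ (vmap f v)))   ≡⟨ mod₃-sh (f (ϕ v)) (ϕ (vmap f v)) ⟩
    a (vmap f v) - proj₂ (f (ϕ v))       ≡⟨ cong₂ (λ w k → a w - proj₂ k) (cong proj₁ (action F v 0F)) f-ϕ ⟩
    a (π v) - (a v +₃ twist F v)         ≡⟨ cong (a (π v) +₃_) (⁻¹-∙-comm (a v) (twist F v)) ⟨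
    a (π v) +₃ (-₃ a v +₃ -₃ twist F v)  ≡⟨ +₃-assoc (a (π v)) (-₃ a v) _ ⟨
    (a (π v) - a v) - twist F v          ∎
    where
    f-ϕ : f (ϕ v) ≡ (π v , a v +₃ twist F v)
    f-ϕ = trans (cong (λ w → f (w , a v)) (choice v)) (action F v (a v))

shOf-twistedForm : ∀ {m} {f : Corner m → Corner m} (F : TwistedForm f) →
                   shOf f ≡ toℕ (-₃ totalTwist F)
shOf-twistedForm {f = f} F =
  trans (sym (toℕ-mod₃ (shSum f (λ v → v , 0F)))) (cong toℕ (mod₃-shSum F (λ _ → refl)))

shSum-choice-independent : ∀ {m} {f : Corner m → Corner m} {ϕ ψ : Fin m → Corner m} →
                           TwistedForm f → IsChoice ϕ → IsChoice ψ → shSum f ϕ % 3 ≡ shSum f ψ % 3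
shSum-choice-independent {f = f} {ϕ} {ψ} F choiceϕ choiceψ = begin
  shSum f ϕ % 3           ≡⟨ toℕ-mod₃ (shSum f ϕ) ⟨
  toℕ (mod₃ (shSum f ϕ))  ≡⟨ cong toℕ (trans (mod₃-shSum F choiceϕ) (sym (mod₃-shSum F choiceψ))) ⟩
  toℕ (mod₃ (shSum f ψ))  ≡⟨ toℕ-mod₃ (shSum f ψ) ⟩
  shSum f ψ % 3           ∎
  where open ≡-Reasoning

shOf-∘ : ∀ {m} {f g : Corner m → Corner m} → TwistedForm f → TwistedForm g →
         shOf (λ c → f (g c)) ≡ (shOf f + shOf g) % 3
shOf-∘ {f = f} {g} F G = begin
  shOf (λ c → f (g c))                     ≡⟨ shOf-twistedForm (twistedForm-∘ F G) ⟩
  toℕ (-₃ totalTwist (twistedForm-∘ F G))  ≡⟨ cong (λ x → toℕ (-₃ x)) (totalTwist-∘ F G) ⟩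
  toℕ (-₃ (tF +₃ tG))                      ≡⟨ cong toℕ (⁻¹-∙-comm tF tG) ⟨
  toℕ (-₃ tF +₃ -₃ tG)                     ≡⟨ toℕ-+₃ (-₃ tF) (-₃ tG) ⟩
  (toℕ (-₃ tF) + toℕ (-₃ tG)) % 3          ≡⟨ cong₂ (λ a b → (a + b) % 3) (shOf-twistedForm F) (shOf-twistedForm G) ⟨
  (shOf f + shOf g) % 3                    ∎
  where
  open ≡-Reasoning
  tF tG : Fin 3
  tF = totalTwist F
  tG = totalTwist G

-- Faces and side movements

rot³ : ∀ {m} (c : Corner m) → rot (rot (rot c)) ≡ c
rot³ (v , 0F) = refl
rot³ (v , 1F) = refl
rot³ (v , 2F) = refl

rot-injective : ∀ {m} → Injective _≡_ _≡_ (rot {m})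
rot-injective {x = x} {y} e = trans (sym (rot³ x)) (trans (cong (λ c → rot (rot c)) e) (rot³ y))

iter-rot : ∀ {m} (t : Fin 3) (c : Corner m) → iter rot (toℕ t) c ≡ (vertexOf c , t +₃ proj₂ c)
iter-rot 0F c = refl
iter-rot 1F c = refl
iter-rot 2F c = refl

φ-injective : ∀ {m} (M : Map3 m) → Injective _≡_ _≡_ (Map3.φ M)
φ-injective M {x} {y} e =
  rot-injective (trans (sym (α-invol (rot x))) (trans (cong α e) (α-invol (rot y))))
  where open Map3 M

module Face {m} (M : Map3 m) (d₀ : Corner m) where
  open Map3 M

  corner : ℕ → Corner m
  corner i = iter φ i d₀

  vertex : ℕ → Fin m
  vertex i = vertexOf (corner i)

  position : ℕ → Fin 3
  position i = proj₂ (corner i)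

  -- Among the first m + 1 corners of the face two share a vertex; as the face is simple they
  -- are equal, and injectivity of φ brings the walk back to d₀.
  returns : ∃ λ p → corner (suc p) ≡ d₀
  returns with pigeonhole (n<1+n m) (λ (i : Fin (suc m)) → vertex (toℕ i))
  ... | i , j , i<j , same = q , iter-cancel φ (φ-injective M) (toℕ i) (suc q) repeat
    where
    q : ℕ
    q = toℕ j ∸ suc (toℕ i)
    repeat : corner (toℕ i) ≡ corner (toℕ i + suc q)
    repeat = trans (face-simple d₀ (toℕ i) (toℕ j) same)
                   (cong corner (sym (trans (+-suc (toℕ i) q) (m+[n∸m]≡n i<j))))

  p : ℕ
  p = proj₁ returns

  corner-period : ∀ i → corner (suc p + i) ≡ corner i
  corner-period i = begin
    corner (suc p + i)               ≡⟨ cong corner (+-comm (suc p) i) ⟩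
    corner (i + suc p)               ≡⟨ iter-+ φ i (suc p) d₀ ⟩
    iter φ i (corner (suc p))        ≡⟨ cong (iter φ i) (proj₂ returns) ⟩
    corner i                         ∎
    where open ≡-Reasoning

  OnFace : Fin m → Set
  OnFace v = ∃ λ i → vertex i ≡ v

  onFace? : ∀ v → Dec (OnFace v)
  onFace? v = map′ (λ (j , e) → toℕ j , e) reduce (any? (λ j → vertex (toℕ j) ≟ v))
    where
    reduce : OnFace v → ∃ λ (j : Fin (suc p)) → vertex (toℕ j) ≡ v
    reduce (i , e) = i mod suc p , (begin
      vertex (toℕ (i mod suc p))  ≡⟨ cong vertex (toℕ-fromℕ< (m%n<n i (suc p))) ⟩
      vertex (i % suc p)          ≡⟨ cong vertexOf (iter-% φ (proj₂ returns) i) ⟩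
      vertex i                    ≡⟨ e ⟩
      v                           ∎)
      where open ≡-Reasoning

  same-corner : ∀ {i j v} → vertex i ≡ v → vertex j ≡ v → corner i ≡ corner j
  same-corner {i} {j} eᵢ eⱼ = face-simple d₀ i j (trans eᵢ (sym eⱼ))

  walk-from : ∀ {v} → ℕ → Dec (OnFace v) → Corner m
  walk-from n (yes (i , _)) = corner (n + i)
  walk-from {v} n (no _) = v , 0F

  -- The corner n steps along the face from its corner at v; junk value (v , 0) off the face.
  walk : ℕ → Fin m → Corner m
  walk n v = walk-from n (onFace? v)

  walk-on : ∀ n i {v} → vertex i ≡ v → walk n v ≡ corner (n + i)
  walk-on n i {v} e = from (onFace? v)
    where
    from : (d : Dec (OnFace v)) → walk-from n d ≡ corner (n + i)
    from (yes (j , e')) = begin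
      iter φ (n + j) d₀          ≡⟨ iter-+ φ n j d₀ ⟩
      iter φ n (corner j)        ≡⟨ cong (iter φ n) (same-corner {j} {i} e' e) ⟩
      iter φ n (corner i)        ≡⟨ iter-+ φ n i d₀ ⟨
      corner (n + i)             ∎
      where open ≡-Reasoning
    from (no off) = ⊥-elim (off (i , e))

  walk-off : ∀ {v} n → ¬ OnFace v → walk n v ≡ (v , 0F)
  walk-off {v} n off = from (onFace? v)
    where
    from : (d : Dec (OnFace v)) → walk-from n d ≡ (v , 0F)
    from (yes on) = ⊥-elim (off on)
    from (no _) = refl

  walk-+ : ∀ n n' v → walk n (vertexOf (walk n' v)) ≡ walk (n + n') v
  walk-+ n n' v = from (onFace? v)
    where
    open ≡-Reasoning
    from : Dec (OnFace v) → walk n (vertexOf (walk n' v)) ≡ walk (n + n') v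
    from (yes (i , e)) = begin
      walk n (vertexOf (walk n' v))  ≡⟨ cong (walk n ∘ vertexOf) (walk-on n' i e) ⟩
      walk n (vertex (n' + i))       ≡⟨ walk-on n (n' + i) refl ⟩
      corner (n + (n' + i))          ≡⟨ cong corner (+-assoc n n' i) ⟨
      corner (n + n' + i)            ≡⟨ walk-on (n + n') i e ⟨
      walk (n + n') v                ∎
    from (no off) = begin
      walk n (vertexOf (walk n' v))  ≡⟨ cong (walk n ∘ vertexOf) (walk-off n' off) ⟩
      walk n v                       ≡⟨ walk-off n off ⟩
      (v , 0F)                       ≡⟨ walk-off (n + n') off ⟨
      walk (n + n') v                ∎

  walk-around : ∀ v → vertexOf (walk (suc p) v) ≡ v
  walk-around v = from (onFace? v)
    where
    from : Dec (OnFace v) → vertexOf (walk (suc p) v) ≡ v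
    from (yes (i , e)) = trans (cong vertexOf (trans (walk-on (suc p) i e) (corner-period i))) e
    from (no off) = cong vertexOf (walk-off (suc p) off)

  next : Fin m → Fin m
  next v = vertexOf (walk 1 v)

  label : Fin m → Fin 3
  label v = proj₂ (walk 0 v)

  next-perm : Permutation m m
  next-perm = Perm.permutation next prev next-prev prev-next
    where
    prev : Fin m → Fin m
    prev v = vertexOf (walk p v)
    next-prev : ∀ v → next (prev v) ≡ v
    next-prev v = trans (cong vertexOf (walk-+ 1 p v)) (walk-around v)
    prev-next : ∀ v → prev (next v) ≡ v
    prev-next v = begin
      vertexOf (walk p (next v))  ≡⟨ cong vertexOf (walk-+ p 1 v) ⟩
      vertexOf (walk (p + 1) v)   ≡⟨ cong (λ n → vertexOf (walk n v)) (+-comm p 1) ⟩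
      vertexOf (walk (suc p) v)   ≡⟨ walk-around v ⟩
      v                           ∎
      where open ≡-Reasoning

  module _ {s : Corner m → Corner m} (side : IsSideMovement M d₀ s) where

    s-walk : ∀ v k → s (v , k) ≡ (next v , k +₃ (proj₂ (walk 1 v) - label v))
    s-walk v k = from (onFace? v)
      where
      open ≡-Reasoning
      landing : Corner m → Corner m → Corner m
      landing c c' = vertexOf c , k +₃ (proj₂ c - proj₂ c')
      from : Dec (OnFace v) → s (v , k) ≡ landing (walk 1 v) (walk 0 v)
      from (yes (i , e)) = begin
        s (v , k)                                            ≡⟨ cong s at-corner ⟨
        s (iter rot (toℕ t) (corner i))                      ≡⟨ proj₁ side i (toℕ t) ⟩
        iter rot (toℕ t) (corner (suc i))                    ≡⟨ iter-rot t (corner (suc i)) ⟩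
        (vertex (suc i) , t +₃ position (suc i))             ≡⟨ cong (vertex (suc i) ,_) reassociate ⟩
        landing (corner (suc i)) (corner i)                  ≡⟨ cong₂ landing (walk-on 1 i e) (walk-on 0 i e) ⟨
        landing (walk 1 v) (walk 0 v)                        ∎
        where
        t : Fin 3
        t = k - position i
        at-corner : iter rot (toℕ t) (corner i) ≡ (v , k)
        at-corner = trans (iter-rot t (corner i)) (cong₂ _,_ e (//-rightDividesˡ (position i) k))
        reassociate : t +₃ position (suc i) ≡ k +₃ (position (suc i) - position i)
        reassociate = trans (+₃-assoc k _ _) (cong (k +₃_) (+₃-comm (-₃ position i) _))
      from (no off) = begin
        s (v , k)                      ≡⟨ proj₂ side (v , k) (λ i e → off (i , sym e)) ⟩
        (v , k)                        ≡⟨ cong (v ,_) (+₃-identityʳ k) ⟨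
        landing (v , 0F) (v , 0F)      ≡⟨ cong₂ landing (walk-off 1 off) (walk-off 0 off) ⟨
        landing (walk 1 v) (walk 0 v)  ∎

    sideMovement-twistedForm : TwistedForm s
    sideMovement-twistedForm = record
      { vperm  = next-perm
      ; twist  = λ v → label (next v) - label v
      ; action = λ v k → trans (s-walk v k) (cong (λ c → next v , k +₃ (c - label v)) (label-next v))
      }
      where
      label-next : ∀ v → proj₂ (walk 1 v) ≡ label (next v)
      label-next v = cong proj₂ (sym (walk-+ 0 1 v))

    sideMovement-totalTwist : totalTwist sideMovement-twistedForm ≡ 0F
    sideMovement-totalTwist = ∑-coboundary ℤ₃ next-perm label

rubik-twistedForm : ∀ {m} {M : Map3 m} {f} → Rubik M f → Σ (TwistedForm f) (λ F → totalTwist F ≡ 0F)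
rubik-twistedForm {m} rubik-id = twistedForm-id , totalTwist-id {m}
rubik-twistedForm {M = M} (rubik-step d₀ s _ side r) with rubik-twistedForm r
... | G , G₀ = twistedForm-∘ S G , trans (totalTwist-∘ S G) (cong₂ _+₃_ S₀ G₀)
  where
  open Face M d₀
  S : TwistedForm s
  S = sideMovement-twistedForm side
  S₀ : totalTwist S ≡ 0F
  S₀ = sideMovement-totalTwist side

rubik-shOf : ∀ {m} {M : Map3 m} {f} → Rubik M f → shOf f ≡ 0
rubik-shOf r with rubik-twistedForm r
... | F , F₀ = trans (shOf-twistedForm F) (cong (λ x → toℕ (-₃ x)) F₀)

rotate₀ : ∀ {m} → Corner (suc m) → Corner (suc m)
rotate₀ (0F , k) = 0F , suc3 k
rotate₀ (Fin.suc v , k) = Fin.suc v , k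

rotate₀³ : ∀ {m} (c : Corner (suc m)) → rotate₀ (rotate₀ (rotate₀ c)) ≡ c
rotate₀³ (0F , k) = cong (0F ,_) (suc3³ k)
rotate₀³ (Fin.suc v , k) = refl

rotate₀-isOrMap : ∀ {m} → IsOrMap (rotate₀ {m})
rotate₀-isOrMap = record
  { inverse         = λ c → rotate₀ (rotate₀ c)
  ; inverseˡ        = rotate₀³
  ; inverseʳ        = rotate₀³
  ; preserves-order = λ { (0F , k) → refl ; (Fin.suc v , k) → refl }
  }

sumFin-zero : ∀ m → sumFin m (λ _ → 0) ≡ 0
sumFin-zero zero = refl
sumFin-zero (suc m) = sumFin-zero m

shOf-rotate₀ : ∀ m → shOf (rotate₀ {m}) ≡ 2
shOf-rotate₀ m = cong (λ n → (2 + n) % 3) (sumFin-zero m)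

orMap-with-nonzero-sh : ∀ {m} → 0 < m → ∃ λ (f : Corner m → Corner m) → IsOrMap f × shOf f ≢ 0
orMap-with-nonzero-sh {suc m} _ =
  rotate₀ , rotate₀-isOrMap , λ sh≡0 → contradiction (trans (sym (shOf-rotate₀ m)) sh≡0) λ ()

theorem1 : (m : ℕ) (M : Map3 m) →
    -- (i)
    (∀ (v : Fin m) k k' k'' →
       sh {m} (v , k) (v , k'') ≡ (sh {m} (v , k) (v , k') + sh {m} (v , k') (v , k'')) % 3) ×
    -- (ii)
    (∀ (f : Corner m → Corner m) → IsOrMap f → ∀ ϕ ψ → IsChoice ϕ → IsChoice ψ →
       shSum f ϕ % 3 ≡ shSum f ψ % 3) ×
    -- (iii)
    (∀ (f g : Corner m → Corner m) → IsOrMap f → IsOrMap g →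
       shOf (λ c → f (g c)) ≡ (shOf f + shOf g) % 3) ×
    -- (iv)
    (∃ λ (f : Corner m → Corner m) → IsOrMap f × shOf f ≢ 0) ×
    -- (v)
    (∀ f → Rubik M f → shOf f ≡ 0)
theorem1 m M =
  (λ v k k' k'' → sh-additive (v , k) (v , k') (v , k'')) ,
  (λ f isOrMap ϕ ψ → shSum-choice-independent (orMap-twistedForm isOrMap)) ,
  (λ f g isOrMapᶠ isOrMapᵍ → shOf-∘ (orMap-twistedForm isOrMapᶠ) (orMap-twistedForm isOrMapᵍ)) ,
  orMap-with-nonzero-sh (Map3.nonempty M) ,
  (λ f → rubik-shOf)
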